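{- Let $n,k\in\mathbb{N}$ with $k\ge 2$ and $n\ge 3k+2$. Then the pendant path graph $P_n^*$ does not have the $(n-k)$-EKR property.
   Context: All graphs are finite and simple. For a graph $G$ and $r\in\mathbb{N}$, $\mathcal{I}^{(r)}(G)$ denotes the family of independent $r$-subsets of $V(G)$. A subfamily $\mathcal{A}\subseteq\mathcal{I}^{(r)}(G)$ is intersecting if every two members have nonempty intersection. For $v\in V(G)$, the $r$-star centered at $v$ is $\{A\in\mathcal{I}^{(r)}(G): v\in A\}$. A graph $G$ has the $r$-EKR property (is $r$-EKR) if every largest intersecting subfamily of $\mathcal{I}^{(r)}(G)$ is an $r$-star, i.e., all its members contain a common vertex. The pendant path graph $P_n^*$ has vertices $x_1,\dots,x_n,p_1,\dots,p_n$ and edges $x_ix_{i+1}$ for $1\le i\le n-1$ together with $x_ip_i$ for $1\le i\le n$. -}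

module Defs where

open import Data.Nat using (ℕ; suc; _+_; _≤_)
open import Data.Fin using (Fin; toℕ; splitAt)
open import Data.Fin.Subset using (Subset; _∈_; ∣_∣)
open import Data.Sum using (_⊎_; inj₁; inj₂)
open import Data.Product using (_×_; ∃; Σ)
open import Data.List using (List; length)
import Data.List.Membership.Propositional as L
open import Data.List.Relation.Unary.All using (All)
open import Data.List.Relation.Unary.Unique.Propositional using (Unique)
open import Relation.Binary.PropositionalEquality using (_≡_)
open import Relation.Nullary using (¬_)
open import Function.Bundles using (_⇔_)

record Graph : Set₁ where
  field
    N   : ℕ
    Adj : Fin N → Fin N → Set
open Graph public

Independent : (G : Graph) → Subset (N G) → Set
Independent G A = ∀ u v → u ∈ A → v ∈ A → ¬ Adj G u v

IndepR : (G : Graph) → ℕ → Subset (N G) → Set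
IndepR G r A = Independent G A × ∣ A ∣ ≡ r

record Family (G : Graph) (r : ℕ) : Set where
  constructor family
  field
    sets    : List (Subset (N G))
    indep   : All (IndepR G r) sets
    nodup   : Unique sets
open Family public

size : ∀ {G r} → Family G r → ℕ
size F = length (sets F)

Intersecting : ∀ {G r} → Family G r → Set
Intersecting {G} F =
  ∀ A B → A L.∈ sets F → B L.∈ sets F → ∃ λ (v : Fin (N G)) → v ∈ A × v ∈ B

LargestIntersecting : ∀ {G r} → Family G r → Set
LargestIntersecting {G} {r} F =
  Intersecting F × (∀ (F′ : Family G r) → Intersecting F′ → size F′ ≤ size F)

IsStarAt : ∀ {G r} → Family G r → Fin (N G) → Set
IsStarAt {G} {r} F v = ∀ (A : Subset (N G)) → (A L.∈ sets F) ⇔ (IndepR G r A × v ∈ A)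

EKR : Graph → ℕ → Set
EKR G r = ∀ (F : Family G r) → LargestIntersecting F → ∃ λ v → IsStarAt F v

-- Pendant path graph P_n^*: vertices x_i = inj₁ i, p_i = inj₂ i (i : Fin n)
data PAdj (n : ℕ) : Fin n ⊎ Fin n → Fin n ⊎ Fin n → Set where
  path-r : (i j : Fin n) → suc (toℕ i) ≡ toℕ j → PAdj n (inj₁ i) (inj₁ j)
  path-l : (i j : Fin n) → toℕ i ≡ suc (toℕ j) → PAdj n (inj₁ i) (inj₁ j)
  pend-r : (i : Fin n) → PAdj n (inj₁ i) (inj₂ i)
  pend-l : (i : Fin n) → PAdj n (inj₂ i) (inj₁ i)

-- Vertex set Fin (n + n): the first n are x_1..x_n, the last n are p_1..p_n.
PendantPath : ℕ → Graph
PendantPath n = record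
  { N   = n + n
  ; Adj = λ u v → PAdj n (splitAt n u) (splitAt n v)
  }

-- Write r = n - k. For every vertex w we find an independent r-set B ∌ w meeting every
-- independent r-set; then B can be added to any star at w without destroying the intersecting
-- property, so no star is a largest intersecting family, while one exists because family sizes
-- are bounded. B consists of the pendants p_i for i outside a block of k consecutive columns
-- around the column of w. An independent set avoiding B has only path vertices x_i in the
-- other columns, hence at most one vertex in any two consecutive such columns; as these
-- columns contain k + 1 disjoint consecutive pairs (for a suitable block, once n ≥ 3k + 2),
-- such a set has at most n - (k + 1) < r vertices.
module Submission where

open import Defs
open import Data.Nat using (ℕ; _≤_; _+_; _*_; _∸_)
open import Relation.Nullary using (¬_)

open import Data.Nat using (zero; suc; z≤n; s≤s; s≤s⁻¹; _<_; _^_; _<?_; ⌊_/2⌋)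
open import Data.Nat.Properties
open import Data.Nat.Solver using (module +-*-Solver)
open import Data.Bool using (Bool)
open import Data.Fin as Fin using (Fin; toℕ; splitAt; _↑ˡ_; _↑ʳ_; combine)
open import Data.Fin.Properties
  using ( 2↔Bool; combine-injective; injective⇒≤; toℕ<n
        ; splitAt-↑ˡ; splitAt-↑ʳ; splitAt⁻¹-↑ˡ; splitAt⁻¹-↑ʳ)
open import Data.Fin.Subset
  using (Subset; inside; outside; _∈_; _∉_; ∣_∣; _∪_; _∩_; Empty)
  renaming (⊥ to ∅)
open import Data.Fin.Subset.Properties
  using (∉⊥; ∣⊥∣≡0; drop-∷-Empty; nonempty?; x∈p∩q⁺; x∈p∩q⁻; x∈p∪q⁻)
open import Data.Vec as Vec using ([]; _∷_; _++_; here; there)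
open import Data.List as List using (List)
import Data.List.Membership.Propositional as List
open import Data.List.Membership.Propositional.Properties using (∈-lookup)
import Data.List.Relation.Unary.All as All
open import Data.List.Relation.Unary.All using ([]; _∷_)
open import Data.List.Relation.Unary.AllPairs using ([]; _∷_)
import Data.List.Relation.Unary.Any as Any
open import Data.List.Relation.Unary.Unique.Propositional using (Unique)
open import Data.Product using (∃; _×_; _,_; proj₁; proj₂; map₂; swap)
open import Data.Sum using (inj₁; inj₂)
open import Data.Empty using (⊥; ⊥-elim)
open import Function using (_∘_)
open import Function.Bundles using (Equivalence; Injection; _↣_)
open import Function.Definitions using (Injective)
open import Function.Properties.Inverse using (↔-sym; ↔⇒↣)
open import Relation.Nullary using (yes; no)
open import Relation.Nullary.Decidable.Core using (¬¬-excluded-middle)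
open import Relation.Unary using (Pred)
open import Relation.Binary.PropositionalEquality

IsMaximum : ∀ {a p} {A : Set a} → Pred A p → (A → ℕ) → Pred A _
IsMaximum P μ x = P x × ∀ y → P y → μ y ≤ μ x

-- A maximum need not be computable, but under a double negation one may decide at each step
-- whether a strictly larger element exists; the bound ends the ascent.
¬¬-maximum : ∀ {a p} {A : Set a} (P : Pred A p) (μ : A → ℕ) {bound : ℕ} →
             (∀ x → P x → μ x ≤ bound) → ∀ {x} → P x → ¬ ¬ ∃ (IsMaximum P μ)
¬¬-maximum P μ {bound} bounded {x} px = ascend bound px (m≤n+m bound (μ x))
  where
  ascend : ∀ d {x} → P x → bound ≤ μ x + d → ¬ ¬ ∃ (IsMaximum P μ)
  climb  : ∀ d {x y} → P y → μ x < μ y → bound ≤ μ x + d → ¬ ¬ ∃ (IsMaximum P μ)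

  ascend d {x} px slack noMaximum = ¬¬-excluded-middle {A = ∃ λ y → P y × μ x < μ y} λ where
    (yes (y , py , x<y)) → climb d py x<y slack noMaximum
    (no noLarger) → noMaximum (x , px , λ y py → ≮⇒≥ (λ x<y → noLarger (y , py , x<y)))

  climb zero {x} {y} py x<y slack =
    ⊥-elim (<⇒≱ x<y (≤-trans (bounded y py) (subst (bound ≤_) (+-identityʳ (μ x)) slack)))
  climb (suc d) {x} {y} py x<y slack =
    ascend d py (≤-trans slack (≤-trans (≤-reflexive (+-suc (μ x) d)) (+-monoˡ-≤ d x<y)))

bit : Bool ↣ Fin 2
bit = ↔⇒↣ (↔-sym 2↔Bool)

encode : ∀ {m} → Subset m → Fin (2 ^ m)
encode []      = Fin.zero
encode (b ∷ p) = combine (Injection.to bit b) (encode p)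

encode-injective : ∀ {m} → Injective _≡_ _≡_ (encode {m})
encode-injective {x = []}    {[]}    _  = refl
encode-injective {x = a ∷ p} {b ∷ q} eq with combine-injective _ _ _ _ eq
... | a≡b , p≡q = cong₂ _∷_ (Injection.injective bit a≡b) (encode-injective p≡q)

Unique⇒lookup-injective : ∀ {a} {A : Set a} {xs : List A} →
                          Unique xs → Injective _≡_ _≡_ (List.lookup xs)
Unique⇒lookup-injective (_ ∷ _) {Fin.zero} {Fin.zero} _ = refl
Unique⇒lookup-injective (x≢ ∷ _) {Fin.zero} {Fin.suc j} eq = ⊥-elim (All.lookup x≢ (∈-lookup j) eq)
Unique⇒lookup-injective (x≢ ∷ _) {Fin.suc i} {Fin.zero} eq = ⊥-elim (All.lookup x≢ (∈-lookup i) (sym eq))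
Unique⇒lookup-injective (_ ∷ u) {Fin.suc i} {Fin.suc j} eq = cong Fin.suc (Unique⇒lookup-injective u eq)

size≤2^N : ∀ {G r} (F : Family G r) → size F ≤ 2 ^ N G
size≤2^N F = injective⇒≤ (Unique⇒lookup-injective (nodup F) ∘ encode-injective)

record AvoidingTransversal (G : Graph) (r : ℕ) (w : Fin (N G)) : Set where
  field
    B           : Subset (N G)
    independent : IndepR G r B
    avoids      : w ∉ B
    meets       : ∀ A → IndepR G r A → ∃ λ v → v ∈ A × v ∈ B

extend-star : ∀ {G r w} (F : Family G r) → Intersecting F → IsStarAt F w →
              AvoidingTransversal G r w → ∃ λ (F′ : Family G r) → Intersecting F′ × size F < size F′
extend-star {G} {r} {w} F intersecting star T = F′ , intersecting′ , ≤-refl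
  where
  open AvoidingTransversal T
  B∉F : ∀ {A} → A List.∈ sets F → B ≢ A
  B∉F A∈F refl = avoids (proj₂ (Equivalence.to (star B) A∈F))
  F′ : Family G r
  F′ = family (B List.∷ sets F) (independent ∷ indep F) (All.tabulate B∉F ∷ nodup F)
  intersecting′ : Intersecting F′
  intersecting′ _ _ (Any.here refl) (Any.here refl)  = meets B independent
  intersecting′ _ A (Any.here refl) (Any.there A∈F)  = map₂ swap (meets A (All.lookup (indep F) A∈F))
  intersecting′ A _ (Any.there A∈F) (Any.here refl)  = meets A (All.lookup (indep F) A∈F)
  intersecting′ A A′ (Any.there A∈F) (Any.there A′∈F) = intersecting A A′ A∈F A′∈F

transversals⇒¬EKR : ∀ {G r} → (∀ w → AvoidingTransversal G r w) → ¬ EKR G r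
transversals⇒¬EKR {G} {r} transversal ekr =
  ¬¬-maximum Intersecting size (λ F _ → size≤2^N F) {empty} (λ _ _ ()) no-largest
  where
  empty : Family G r
  empty = family List.[] [] []
  no-largest : ¬ ∃ (IsMaximum Intersecting (size {G} {r}))
  no-largest (F , largest) with ekr F largest
  ... | w , star with extend-star F (proj₁ largest) star (transversal w)
  ... | F′ , intersecting′ , F<F′ = <⇒≱ F<F′ (proj₂ largest F′ intersecting′)

∈-++⁺ˡ : ∀ {m n} {i : Fin m} {p : Subset m} {q : Subset n} → i ∈ p → i ↑ˡ n ∈ p ++ q
∈-++⁺ˡ here        = here
∈-++⁺ˡ (there i∈p) = there (∈-++⁺ˡ i∈p)

∈-++⁺ʳ : ∀ {m n} {j : Fin n} (p : Subset m) {q : Subset n} → j ∈ q → m ↑ʳ j ∈ p ++ q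
∈-++⁺ʳ []      j∈q = j∈q
∈-++⁺ʳ (_ ∷ p) j∈q = there (∈-++⁺ʳ p j∈q)

∈-++⁻ˡ : ∀ {m n} {i : Fin m} (p : Subset m) {q : Subset n} → i ↑ˡ n ∈ p ++ q → i ∈ p
∈-++⁻ˡ {i = Fin.zero}  (_ ∷ p) here  = here
∈-++⁻ˡ {i = Fin.suc i} (_ ∷ p) (there i∈) = there (∈-++⁻ˡ p i∈)

∈-++⁻ʳ : ∀ {m n} {j : Fin n} (p : Subset m) {q : Subset n} → m ↑ʳ j ∈ p ++ q → j ∈ q
∈-++⁻ʳ []      j∈ = j∈
∈-++⁻ʳ (_ ∷ p) (there j∈) = ∈-++⁻ʳ p j∈

∣p++q∣≡∣p∣+∣q∣ : ∀ {m n} (p : Subset m) (q : Subset n) → ∣ p ++ q ∣ ≡ ∣ p ∣ + ∣ q ∣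
∣p++q∣≡∣p∣+∣q∣ []            q = refl
∣p++q∣≡∣p∣+∣q∣ (inside ∷ p)  q = cong suc (∣p++q∣≡∣p∣+∣q∣ p q)
∣p++q∣≡∣p∣+∣q∣ (outside ∷ p) q = ∣p++q∣≡∣p∣+∣q∣ p q

∣p∪q∣≡∣p∣+∣q∣ : ∀ {m} (p q : Subset m) → Empty (p ∩ q) → ∣ p ∪ q ∣ ≡ ∣ p ∣ + ∣ q ∣
∣p∪q∣≡∣p∣+∣q∣ []            []            _ = refl
∣p∪q∣≡∣p∣+∣q∣ (inside ∷ p)  (inside ∷ q)  disjoint = ⊥-elim (disjoint (Fin.zero , here))
∣p∪q∣≡∣p∣+∣q∣ (inside ∷ p)  (outside ∷ q) disjoint = cong suc (∣p∪q∣≡∣p∣+∣q∣ p q (drop-∷-Empty disjoint))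
∣p∪q∣≡∣p∣+∣q∣ (outside ∷ p) (inside ∷ q)  disjoint = begin
  suc ∣ p ∪ q ∣     ≡⟨ cong suc (∣p∪q∣≡∣p∣+∣q∣ p q (drop-∷-Empty disjoint)) ⟩
  suc (∣ p ∣ + ∣ q ∣) ≡⟨ +-suc ∣ p ∣ ∣ q ∣ ⟨
  ∣ p ∣ + suc ∣ q ∣   ∎
  where open ≡-Reasoning
∣p∪q∣≡∣p∣+∣q∣ (outside ∷ p) (outside ∷ q) disjoint = ∣p∪q∣≡∣p∣+∣q∣ p q (drop-∷-Empty disjoint)

NoConsecutive : ∀ {m} → Subset m → Set
NoConsecutive s = ∀ i j → suc (toℕ i) ≡ toℕ j → i ∈ s → j ∈ s → ⊥

NoConsecutive-tail : ∀ {m b} {s : Subset m} → NoConsecutive (b ∷ s) → NoConsecutive s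
NoConsecutive-tail noConsecutive i j i+1≡j i∈s j∈s =
  noConsecutive (Fin.suc i) (Fin.suc j) (cong suc i+1≡j) (there i∈s) (there j∈s)

consecutivePairs : ∀ {m} → Subset m → ℕ
consecutivePairs []                     = 0
consecutivePairs (outside ∷ s)          = consecutivePairs s
consecutivePairs (inside ∷ [])          = 0
consecutivePairs (inside ∷ outside ∷ s) = consecutivePairs s
consecutivePairs (inside ∷ inside ∷ s)  = suc (consecutivePairs s)

∣∷∣+≤ : ∀ {m c k} b (p : Subset m) → ∣ p ∣ + c ≤ k → ∣ b ∷ p ∣ + c ≤ suc k
∣∷∣+≤ inside  _ ≤k = s≤s ≤k
∣∷∣+≤ outside _ ≤k = m≤n⇒m≤1+n ≤k

+-suc-≤ : ∀ a {b k} → a + b ≤ k → a + suc b ≤ suc k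
+-suc-≤ a {b} {k} ≤k = subst (_≤ suc k) (sym (+-suc a b)) (s≤s ≤k)

-- Each pair counted by consecutivePairs s contains a column outside occ.
∣occ∣+consecutivePairs≤ : ∀ {m} (occ s : Subset m) → NoConsecutive (occ ∩ s) →
                          ∣ occ ∣ + consecutivePairs s ≤ m
∣occ∣+consecutivePairs≤ []        []                     _  = z≤n
∣occ∣+consecutivePairs≤ (o ∷ occ) (outside ∷ s)          nc =
  ∣∷∣+≤ o occ (∣occ∣+consecutivePairs≤ occ s (NoConsecutive-tail nc))
∣occ∣+consecutivePairs≤ (o ∷ [])  (inside ∷ [])          _  = ∣∷∣+≤ o [] z≤n
∣occ∣+consecutivePairs≤ (o ∷ occ) (inside ∷ outside ∷ s) nc =
  ∣∷∣+≤ o occ (∣occ∣+consecutivePairs≤ occ (outside ∷ s) (NoConsecutive-tail nc))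
∣occ∣+consecutivePairs≤ (inside ∷ inside ∷ occ) (inside ∷ inside ∷ s) nc =
  ⊥-elim (nc Fin.zero (Fin.suc Fin.zero) refl here (there here))
∣occ∣+consecutivePairs≤ (inside ∷ outside ∷ occ) (inside ∷ inside ∷ s) nc =
  s≤s (+-suc-≤ ∣ occ ∣ (∣occ∣+consecutivePairs≤ occ s (NoConsecutive-tail (NoConsecutive-tail nc))))
∣occ∣+consecutivePairs≤ (outside ∷ o ∷ occ) (inside ∷ inside ∷ s) nc =
  ∣∷∣+≤ o occ
    (+-suc-≤ ∣ occ ∣ (∣occ∣+consecutivePairs≤ occ s (NoConsecutive-tail (NoConsecutive-tail nc))))

module PendantPathGraph (n : ℕ) where

  G : Graph
  G = PendantPath n

  data Vertex : Fin (n + n) → Set where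
    x : (i : Fin n) → Vertex (i ↑ˡ n)
    p : (i : Fin n) → Vertex (n ↑ʳ i)

  vertex : ∀ u → Vertex u
  vertex u with splitAt n u in eq
  ... | inj₁ i = subst Vertex (splitAt⁻¹-↑ˡ eq) (x i)
  ... | inj₂ i = subst Vertex (splitAt⁻¹-↑ʳ eq) (p i)

  x∼p : ∀ i → Adj G (i ↑ˡ n) (n ↑ʳ i)
  x∼p i = subst₂ (PAdj n) (sym (splitAt-↑ˡ n i n)) (sym (splitAt-↑ʳ n n i)) (pend-r i)

  x∼x : ∀ i j → suc (toℕ i) ≡ toℕ j → Adj G (i ↑ˡ n) (j ↑ˡ n)
  x∼x i j i+1≡j = subst₂ (PAdj n) (sym (splitAt-↑ˡ n i n)) (sym (splitAt-↑ˡ n j n)) (path-r i j i+1≡j)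

  p≁p : ∀ i j → ¬ Adj G (n ↑ʳ i) (n ↑ʳ j)
  p≁p i j adj with subst₂ (PAdj n) (splitAt-↑ʳ n n i) (splitAt-↑ʳ n n j) adj
  ... | ()

  pendants : Subset n → Subset (n + n)
  pendants s = ∅ ++ s

  x∉pendants : ∀ {s} i → i ↑ˡ n ∉ pendants s
  x∉pendants i = ∉⊥ ∘ ∈-++⁻ˡ ∅

  p∉pendants : ∀ {s i} → i ∉ s → n ↑ʳ i ∉ pendants s
  p∉pendants i∉s = i∉s ∘ ∈-++⁻ʳ ∅

  ∣pendants∣ : ∀ s → ∣ pendants s ∣ ≡ ∣ s ∣
  ∣pendants∣ s = trans (∣p++q∣≡∣p∣+∣q∣ (∅ {n}) s) (cong (_+ ∣ s ∣) (∣⊥∣≡0 n))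

  pendants-independent : ∀ s → Independent G (pendants s)
  pendants-independent s u v u∈ v∈ with vertex u | vertex v
  ... | x i | _   = ⊥-elim (x∉pendants i u∈)
  ... | p _ | x j = ⊥-elim (x∉pendants j v∈)
  ... | p i | p j = p≁p i j

  -- In the columns of s a set avoiding pendants s can only use path vertices, and consecutive
  -- ones are adjacent.
  avoiding-pendants-≤ : ∀ s xs ps → Independent G (xs ++ ps) → Empty (ps ∩ s) →
                        ∣ xs ++ ps ∣ + consecutivePairs s ≤ n
  avoiding-pendants-≤ s xs ps independent avoids = begin
    ∣ xs ++ ps ∣ + consecutivePairs s ≡⟨ cong (_+ consecutivePairs s) ∣xs++ps∣≡∣xs∪ps∣ ⟩
    ∣ xs ∪ ps ∣ + consecutivePairs s  ≤⟨ ∣occ∣+consecutivePairs≤ (xs ∪ ps) s no-consecutive ⟩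
    n                                 ∎
    where
    open ≤-Reasoning
    no-column : Empty (xs ∩ ps)
    no-column (i , i∈xs∩ps) with x∈p∩q⁻ xs ps i∈xs∩ps
    ... | i∈xs , i∈ps = independent _ _ (∈-++⁺ˡ i∈xs) (∈-++⁺ʳ xs i∈ps) (x∼p i)
    ∣xs++ps∣≡∣xs∪ps∣ : ∣ xs ++ ps ∣ ≡ ∣ xs ∪ ps ∣
    ∣xs++ps∣≡∣xs∪ps∣ = trans (∣p++q∣≡∣p∣+∣q∣ xs ps) (sym (∣p∪q∣≡∣p∣+∣q∣ xs ps no-column))
    path-only : ∀ {i} → i ∈ (xs ∪ ps) ∩ s → i ∈ xs
    path-only i∈ with x∈p∩q⁻ (xs ∪ ps) s i∈
    ... | i∈xs∪ps , i∈s with x∈p∪q⁻ xs ps i∈xs∪ps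
    ...   | inj₁ i∈xs = i∈xs
    ...   | inj₂ i∈ps = ⊥-elim (avoids (_ , x∈p∩q⁺ (i∈ps , i∈s)))
    no-consecutive : NoConsecutive ((xs ∪ ps) ∩ s)
    no-consecutive i j i+1≡j i∈ j∈ =
      independent _ _ (∈-++⁺ˡ (path-only i∈)) (∈-++⁺ˡ (path-only j∈)) (x∼x i j i+1≡j)

  pendants-meet : ∀ s A → Independent G A → n < ∣ A ∣ + consecutivePairs s →
                  ∃ λ v → v ∈ A × v ∈ pendants s
  pendants-meet s A independent n< with Vec.splitAt n A
  ... | xs , ps , refl with nonempty? (ps ∩ s)
  ...   | yes (i , i∈ps∩s) with x∈p∩q⁻ ps s i∈ps∩s
  ...     | i∈ps , i∈s = n ↑ʳ i , ∈-++⁺ʳ xs i∈ps , ∈-++⁺ʳ ∅ i∈s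
  pendants-meet s A independent n< | xs , ps , refl | no avoids =
    ⊥-elim (<⇒≱ n< (avoiding-pendants-≤ s xs ps independent avoids))

  column : ∀ {u} → Vertex u → Fin n
  column (x i) = i
  column (p i) = i

  ∉pendants : ∀ {u s} (v : Vertex u) → column v ∉ s → u ∉ pendants s
  ∉pendants (x i) _   = x∉pendants i
  ∉pendants (p i) i∉s = p∉pendants i∉s

  pendantTransversal : ∀ {r w} s → w ∉ pendants s → ∣ s ∣ ≡ r → n < r + consecutivePairs s →
                       AvoidingTransversal G r w
  pendantTransversal s w∉ ∣s∣≡r n< = record
    { B           = pendants s
    ; independent = pendants-independent s , trans (∣pendants∣ s) ∣s∣≡r
    ; avoids      = w∉
    ; meets       = λ A (independent , ∣A∣≡r) →
        pendants-meet s A independent (subst (λ a → n < a + consecutivePairs s) (sym ∣A∣≡r) n<)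
    }

gap : (m s k : ℕ) → Subset m
gap zero    _       _       = []
gap (suc m) (suc s) k       = inside ∷ gap m s k
gap (suc m) zero    (suc k) = outside ∷ gap m zero k
gap (suc m) zero    zero    = inside ∷ gap m zero zero

∣gap∣+k≡m : ∀ {m} s k → s + k ≤ m → ∣ gap m s k ∣ + k ≡ m
∣gap∣+k≡m {zero}  zero    zero    _           = refl
∣gap∣+k≡m {suc m} (suc s) k       (s≤s s+k≤m) = cong suc (∣gap∣+k≡m s k s+k≤m)
∣gap∣+k≡m {suc m} zero    (suc k) (s≤s k≤m)   = trans (+-suc _ k) (cong suc (∣gap∣+k≡m zero k k≤m))
∣gap∣+k≡m {suc m} zero    zero    _           = cong suc (∣gap∣+k≡m zero zero z≤n)

∉gap : ∀ {m s k} (j : Fin m) → s ≤ toℕ j → toℕ j < s + k → j ∉ gap m s k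
∉gap {suc m} {suc s} (Fin.suc j) (s≤s s≤j) (s≤s j<s+k) (there j∈) = ∉gap j s≤j j<s+k j∈
∉gap {suc m} {zero} {suc k} (Fin.suc j) _ (s≤s j<k) (there j∈) = ∉gap j z≤n j<k j∈
∉gap {suc m} {zero} {suc k} Fin.zero _ _ ()

consecutivePairs-gap-even : ∀ a {m k c} → c * 2 + k ≤ m → c ≤ consecutivePairs (gap m (a * 2) k)
consecutivePairs-gap-even _       {c = zero} _ = z≤n
consecutivePairs-gap-even (suc a) {suc (suc m)} {c = suc c} (s≤s (s≤s ≤m)) =
  s≤s (consecutivePairs-gap-even a ≤m)
consecutivePairs-gap-even zero {suc m} {suc k} {suc c} ≤m =
  consecutivePairs-gap-even zero (s≤s⁻¹ (subst (_≤ suc m) (+-suc (suc c * 2) k) ≤m))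
consecutivePairs-gap-even zero {suc (suc m)} {zero} {suc c} (s≤s (s≤s ≤m)) =
  s≤s (consecutivePairs-gap-even zero ≤m)

consecutivePairs-gap-prefix : ∀ {m s k c} → c * 2 ≤ s → s ≤ m → c ≤ consecutivePairs (gap m s k)
consecutivePairs-gap-prefix {c = zero} _ _ = z≤n
consecutivePairs-gap-prefix {suc (suc m)} {suc (suc s)} {c = suc c} (s≤s (s≤s c*2≤s)) (s≤s (s≤s s≤m)) =
  s≤s (consecutivePairs-gap-prefix c*2≤s s≤m)

gap-pattern : ∀ {n s k} (j : Fin n) → s ≤ toℕ j → toℕ j < s + k → s + k ≤ n →
              suc k ≤ consecutivePairs (gap n s k) →
              ∃ λ bs → j ∉ bs × ∣ bs ∣ ≡ n ∸ k × n < n ∸ k + consecutivePairs bs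
gap-pattern {n} {s} {k} j s≤j j<s+k s+k≤n k<pairs = gap n s k , ∉gap j s≤j j<s+k , ∣gap∣≡n∸k , n<
  where
  open ≤-Reasoning
  ∣gap∣≡n∸k : ∣ gap n s k ∣ ≡ n ∸ k
  ∣gap∣≡n∸k = trans (sym (m+n∸n≡m ∣ gap n s k ∣ k)) (cong (_∸ k) (∣gap∣+k≡m s k s+k≤n))
  n< : n < n ∸ k + consecutivePairs (gap n s k)
  n< = begin-strict
    n                                            ≡⟨ ∣gap∣+k≡m s k s+k≤n ⟨
    ∣ gap n s k ∣ + k                            <⟨ +-monoʳ-< ∣ gap n s k ∣ k<pairs ⟩
    ∣ gap n s k ∣ + consecutivePairs (gap n s k) ≡⟨ cong (_+ consecutivePairs (gap n s k)) ∣gap∣≡n∸k ⟩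
    n ∸ k + consecutivePairs (gap n s k)         ∎

⌊n/2⌋*2≤n : ∀ n → ⌊ n /2⌋ * 2 ≤ n
⌊n/2⌋*2≤n zero          = z≤n
⌊n/2⌋*2≤n (suc zero)    = z≤n
⌊n/2⌋*2≤n (suc (suc n)) = s≤s (s≤s (⌊n/2⌋*2≤n n))

n<⌊n/2⌋*2+2 : ∀ n → n < ⌊ n /2⌋ * 2 + 2
n<⌊n/2⌋*2+2 zero          = s≤s z≤n
n<⌊n/2⌋*2+2 (suc zero)    = s≤s (s≤s z≤n)
n<⌊n/2⌋*2+2 (suc (suc n)) = s≤s (s≤s (n<⌊n/2⌋*2+2 n))

-- The gap of length k around column j starts at an even column or ends at the last one;
-- either way the remaining n - k columns contain k + 1 disjoint consecutive pairs.
gap-around : ∀ {n k} → 2 ≤ k → suc k * 2 + k ≤ n → (j : Fin n) →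
             ∃ λ bs → j ∉ bs × ∣ bs ∣ ≡ n ∸ k × n < n ∸ k + consecutivePairs bs
gap-around {n} {k} 2≤k ≤n j with toℕ j <? n ∸ k
... | yes j<n∸k = gap-pattern j s≤j j<s+k s+k≤n (consecutivePairs-gap-even ⌊ toℕ j /2⌋ ≤n)
  where
  s = ⌊ toℕ j /2⌋ * 2
  s≤j : s ≤ toℕ j
  s≤j = ⌊n/2⌋*2≤n (toℕ j)
  j<s+k : toℕ j < s + k
  j<s+k = ≤-trans (n<⌊n/2⌋*2+2 (toℕ j)) (+-monoʳ-≤ s 2≤k)
  s+k≤n : s + k ≤ n
  s+k≤n = m≤o∸n⇒m+n≤o s (≤-trans (m≤n+m k _) ≤n) (≤-trans s≤j (<⇒≤ j<n∸k))
... | no j≮n∸k = gap-pattern j (≮⇒≥ j≮n∸k) j<n∸k+k (≤-reflexive n∸k+k≡n)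
                   (consecutivePairs-gap-prefix (m+n≤o⇒m≤o∸n (suc k * 2) ≤n) (m∸n≤m n k))
  where
  n∸k+k≡n : n ∸ k + k ≡ n
  n∸k+k≡n = m∸n+n≡m (≤-trans (m≤n+m k _) ≤n)
  j<n∸k+k : toℕ j < n ∸ k + k
  j<n∸k+k = subst (toℕ j <_) (sym n∸k+k≡n) (toℕ<n j)

theorem6 : (n k : ℕ) → 2 ≤ k → 3 * k + 2 ≤ n → ¬ EKR (PendantPath n) (n ∸ k)
theorem6 n k 2≤k 3k+2≤n = transversals⇒¬EKR transversal
  where
  open PendantPathGraph n
  open +-*-Solver
  3k+2≡[k+1]*2+k : 3 * k + 2 ≡ suc k * 2 + k
  3k+2≡[k+1]*2+k = solve 1 (λ k → con 3 :* k :+ con 2 := (con 1 :+ k) :* con 2 :+ k) refl k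
  transversal : ∀ w → AvoidingTransversal G (n ∸ k) w
  transversal w with gap-around 2≤k (subst (_≤ n) 3k+2≡[k+1]*2+k 3k+2≤n) (column (vertex w))
  ... | bs , column∉bs , ∣bs∣≡n∸k , n< =
    pendantTransversal bs (∉pendants (vertex w) column∉bs) ∣bs∣≡n∸k n<
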